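{- Let $g:B\to A$ be a cover and $f:U\to A$ an arrow of $\mathbf C$. Then $|{\rm Hom}(g,f)|\le\deg f$. Moreover, equality holds only if $|{\rm Hom}(g,f\circ i)|=\deg(f\circ i)$ for each $i\in\Sigma(U)$.
   Context: Let $\mathbf C$ be a category and $\mathbf D$ a full subcategory of $\mathbf C$. For arrows $f,g$ of $\mathbf C$ with ${\rm cod}\,f={\rm cod}\,g$, ${\rm Hom}(g,f)$ denotes the collection of all arrows $h$ of $\mathbf C$ with $g=f\circ h$. Standing assumptions: (G1) every diagram $B\to A\leftarrow C$ in $\mathbf D$ has a pullback in $\mathbf C$. (G2) (I) pushouts exist in $\mathbf D$; (II) every arrow of $\mathbf D$ is epic; (III) every monic arrow of $\mathbf D$ is an isomorphism whose inverse is an arrow of $\mathbf D$. (G3) for every object $U$ of $\mathbf C$ there is a set $\Sigma(U)$ of arrows $i$ of $\mathbf C$ with ${\rm dom}\,i$ in $\mathbf D$ and ${\rm cod}\,i=U$ such that for every arrow $u$ of $\mathbf C$ with ${\rm dom}\,u$ in $\mathbf D$ and ${\rm cod}\,u=U$ there is exactly one $i\in\Sigma(U)$ with ${\rm Hom}(u,i)\neq\emptyset$. (G4) there is a function $\deg$ from the collection of arrows of $\mathbf C$ whose codomain lies in $\mathbf D$ to the positive integers such that (I) $\deg(g\circ f)=\deg g\cdot\deg f$ whenever $f,g,g\circ f$ all lie in this collection; (II) $\deg f=\sum_{i\in\Sigma({\rm dom}\,f)}\deg(f\circ i)$ for every such $f$; (III) if $B\xrightarrow{f}A\xleftarrow{g}C$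 is a diagram in $\mathbf D$ with pullback $B\xleftarrow{p}U\xrightarrow{q}C$, then $\deg f=\deg q$ and $\deg g=\deg p$. A cover is an arrow of $\mathbf D$. -}

module Defs where

open import Level using (Level; _⊔_; suc)
open import Data.Nat using (ℕ; _≤_; _<_; _*_; _+_)
open import Data.Fin using (Fin)
open import Data.Product using (Σ; Σ-syntax; ∃; ∃-syntax; _×_; _,_)
open import Relation.Binary.PropositionalEquality using (_≡_)
open import Relation.Nullary using (¬_)
open import Function.Definitions using (Injective)

record Category (o ℓ : Level) : Set (Level.suc (o ⊔ ℓ)) where
  infixr 9 _∘_
  field
    Obj  : Set o
    Hom  : Obj → Obj → Set ℓ
    id   : ∀ {X} → Hom X X
    _∘_  : ∀ {X Y Z} → Hom Y Z → Hom X Y → Hom X Z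
    assoc : ∀ {W X Y Z} (h : Hom Y Z) (g : Hom X Y) (f : Hom W X) →
            (h ∘ g) ∘ f ≡ h ∘ (g ∘ f)
    identityˡ : ∀ {X Y} (f : Hom X Y) → id ∘ f ≡ f
    identityʳ : ∀ {X Y} (f : Hom X Y) → f ∘ id ≡ f

-- Cardinality of the collection {a : A | P a}, measured via injections from Fin k.
AtMost : ∀ {a p} {A : Set a} → (A → Set p) → ℕ → Set (a ⊔ p)
AtMost {A = A} P n =
  ∀ k (e : Fin k → A) → (∀ j → P (e j)) → Injective _≡_ _≡_ e → k ≤ n

HasCard : ∀ {a p} {A : Set a} → (A → Set p) → ℕ → Set (a ⊔ p)
HasCard {A = A} P n =
  AtMost P n × (Σ[ e ∈ (Fin n → A) ] ((∀ j → P (e j)) × Injective _≡_ _≡_ e))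

sumFin : ∀ n → (Fin n → ℕ) → ℕ
sumFin ℕ.zero    f = 0
sumFin (ℕ.suc n) f = f Fin.zero + sumFin n (λ j → f (Fin.suc j))

module _ {o ℓ : Level} (C : Category o ℓ) where
  open Category C

  -- Hom(g,f) = { h | g = f ∘ h }, as a predicate on arrows h : dom g → dom f
  HomOver : ∀ {X Y Z} (g : Hom X Z) (f : Hom Y Z) → Hom X Y → Set ℓ
  HomOver g f h = g ≡ f ∘ h

  ArrInto : Obj → Set (o ⊔ ℓ)
  ArrInto U = Σ[ X ∈ Obj ] Hom X U

  IsPullback : ∀ {B A C' U} (f : Hom B A) (g : Hom C' A) (p : Hom U B) (q : Hom U C') → Set (o ⊔ ℓ)
  IsPullback {B} {A} {C'} {U} f g p q =
    (f ∘ p ≡ g ∘ q) ×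
    (∀ {W} (p' : Hom W B) (q' : Hom W C') → f ∘ p' ≡ g ∘ q' →
      Σ[ h ∈ Hom W U ] ((p ∘ h ≡ p') × (q ∘ h ≡ q') ×
        (∀ h' → p ∘ h' ≡ p' → q ∘ h' ≡ q' → h' ≡ h)))

  IsIso : ∀ {X Y} → Hom X Y → Set ℓ
  IsIso {X} {Y} m = Σ[ h ∈ Hom Y X ] ((h ∘ m ≡ id) × (m ∘ h ≡ id))

  -- Assumptions (G1)–(G4) for a full subcategory D (given by a predicate on objects),
  -- a family Σ(U) of arrows (given by a membership predicate) and a degree function.
  -- deg is given as a total function on arrows; only its values on arrows whose
  -- codomain lies in D are constrained (and used).
  record GaloisSetting (d s : Level) : Set (o ⊔ ℓ ⊔ Level.suc (d ⊔ s)) where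
    field
      D    : Obj → Set d
      Sig  : ∀ {U X} → Hom X U → Set s
      deg  : ∀ {X Y} → Hom X Y → ℕ

      G1 : ∀ {B A C'} → D B → D A → D C' → (f : Hom B A) (g : Hom C' A) →
           Σ[ U ∈ Obj ] Σ[ p ∈ Hom U B ] Σ[ q ∈ Hom U C' ] IsPullback f g p q
      G2-pushout : ∀ {A B C'} → D A → D B → D C' → (f : Hom A B) (g : Hom A C') →
        Σ[ P ∈ Obj ] D P × Σ[ u ∈ Hom B P ] Σ[ v ∈ Hom C' P ]
          ((u ∘ f ≡ v ∘ g) ×
           (∀ {W} → D W → (u' : Hom B W) (v' : Hom C' W) → u' ∘ f ≡ v' ∘ g →
             Σ[ h ∈ Hom P W ] ((h ∘ u ≡ u') × (h ∘ v ≡ v') ×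
               (∀ h' → h' ∘ u ≡ u' → h' ∘ v ≡ v' → h' ≡ h))))
      G2-epic : ∀ {X Y} → D X → D Y → (h : Hom X Y) →
        ∀ {Z} → D Z → (u v : Hom Y Z) → u ∘ h ≡ v ∘ h → u ≡ v
      -- (G2)(III): every monic arrow of D (monic in D) is an isomorphism
      -- (its inverse is automatically an arrow of D, D being full)
      G2-monic : ∀ {X Y} → D X → D Y → (m : Hom X Y) →
        (∀ {Z} → D Z → (u v : Hom Z X) → m ∘ u ≡ m ∘ v → u ≡ v) → IsIso m
      Sig-dom : ∀ {U X} (i : Hom X U) → Sig i → D X
      G3-exists : ∀ {U X} → D X → (u : Hom X U) →
        Σ[ i ∈ ArrInto U ] (Sig (Σ.proj₂ i) × Σ[ h ∈ Hom X (Σ.proj₁ i) ] HomOver u (Σ.proj₂ i) h)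
      G3-unique : ∀ {U X} → D X → (u : Hom X U) → (i i' : ArrInto U) →
        Sig (Σ.proj₂ i) → Σ[ h ∈ Hom X (Σ.proj₁ i) ] HomOver u (Σ.proj₂ i) h →
        Sig (Σ.proj₂ i') → Σ[ h ∈ Hom X (Σ.proj₁ i') ] HomOver u (Σ.proj₂ i') h →
        i ≡ i'
      deg-pos : ∀ {X Y} → D Y → (f : Hom X Y) → 0 < deg f
      G4-mult : ∀ {X Y Z} → D Y → D Z → (f : Hom X Y) (g : Hom Y Z) →
        deg (g ∘ f) ≡ deg g * deg f
      -- (G4)(II): deg f = Σ_{i ∈ Σ(dom f)} deg (f ∘ i); the sum is taken over a
      -- finite enumeration (without repetition) of Σ(dom f)
      G4-sum : ∀ {U A} → D A → (f : Hom U A) →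
        Σ[ n ∈ ℕ ] Σ[ e ∈ (Fin n → ArrInto U) ]
          ((∀ j → Sig (Σ.proj₂ (e j))) × Injective _≡_ _≡_ e ×
           (∀ (i : ArrInto U) → Sig (Σ.proj₂ i) → Σ[ j ∈ Fin n ] e j ≡ i) ×
           (deg f ≡ sumFin n (λ j → deg (f ∘ Σ.proj₂ (e j)))))
      G4-pullback : ∀ {B A C' U} → D B → D A → D C' →
        (f : Hom B A) (g : Hom C' A) (p : Hom U B) (q : Hom U C') →
        IsPullback f g p q → (deg f ≡ deg q) × (deg g ≡ deg p)

-- Every h ∈ Hom(g,f) factors as h = i ∘ t through some i ∈ Σ(U), and then t ∈ Hom(g, f ∘ i); so
-- |Hom(g,f)| ≤ Σᵢ |Hom(g, f ∘ i)|, while deg f = Σᵢ deg (f ∘ i) by (G4)(II).  This reduces the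
-- bound to arrows f with domain in D.  For those, pull g back along f to B ←q– P: elements of
-- Hom(g,f) are sections of q, and by the same factorisation a section of q factors through a
-- section of q ∘ i for i ∈ Σ(P).  A section t of q ∘ i is split monic, hence an isomorphism by
-- (G2)(III), so it is the unique section; thus |Hom(g,f)| ≤ Σᵢ 1 ≤ Σᵢ deg (q ∘ i) = deg q = deg f
-- by (G4)(III).  If |Hom(g,f)| = deg f, every summand of the first estimate must be sharp.
{-# OPTIONS --safe #-}
module Submission where

open import Defs
open import Level using (Level; _⊔_)
open import Data.Bool.Base using (if_then_else_)
open import Data.Nat.Base using (ℕ; zero; suc; _≤_; _+_; z≤n; s≤s)
open import Data.Nat.Properties
  using (≤-reflexive; ≤-trans; ≤-antisym; +-mono-≤; +-monoˡ-≤; +-monoʳ-≤;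
         +-cancelˡ-≤; +-cancelʳ-≤; +-commutativeSemigroup; module ≤-Reasoning)
open import Data.Fin.Base using (Fin; zero; suc)
open import Data.Fin.Properties using (_≟_; suc-injective)
open import Data.Product using (Σ; Σ-syntax; _×_; _,_; proj₁; proj₂)
open import Relation.Nullary.Decidable using (Dec; yes; no; does)
open import Relation.Binary.PropositionalEquality
open import Function.Definitions using (Injective)
open import Algebra.Properties.CommutativeSemigroup +-commutativeSemigroup using (interchange)

record Listing {a p} {A : Set a} (P : A → Set p) : Set (a ⊔ p) where
  constructor listing
  field
    size           : ℕ
    elem           : Fin size → A
    elem-sat       : ∀ j → P (elem j)
    elem-injective : Injective _≡_ _≡_ elem

open Listing

module _ {a p} {A : Set a} {P : A → Set p} where

  size-≤ : ∀ {n} → AtMost P n → (L : Listing P) → size L ≤ n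
  size-≤ bound (listing k e sat inj) = bound k e sat inj

  HasCard-intro : ∀ {n} → AtMost P n → (L : Listing P) → size L ≡ n → HasCard P n
  HasCard-intro bound (listing k e sat inj) refl = bound , e , sat , inj

  AtMost-weaken : ∀ {m n} → m ≤ n → AtMost P m → AtMost P n
  AtMost-weaken m≤n bound k e sat inj = ≤-trans (bound k e sat inj) m≤n

  AtMost-one : (∀ x y → P x → P y → x ≡ y) → AtMost P 1
  AtMost-one unique zero          e sat inj = z≤n
  AtMost-one unique (suc zero)    e sat inj = s≤s z≤n
  AtMost-one unique (suc (suc k)) e sat inj
    with () ← inj (unique (e zero) (e (suc zero)) (sat zero) (sat (suc zero)))

  AtMost-retract : ∀ {b q n} {A′ : Set b} {Q : A′ → Set q}
    (F : ∀ x → P x → A′) (R : A′ → A) →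
    (∀ x px → Q (F x px)) → (∀ x px → R (F x px) ≡ x) → AtMost Q n → AtMost P n
  AtMost-retract F R F-sat R∘F bound k e sat inj =
    bound k (λ j → F (e j) (sat j)) (λ j → F-sat (e j) (sat j))
      (λ {x} {y} Fx≡Fy → inj (trans (sym (R∘F _ (sat x))) (trans (cong R Fx≡Fy) (R∘F _ (sat y)))))

indicator : ∀ {p} {P : Set p} → Dec P → ℕ
indicator d = if does d then 1 else 0

module _ {p} {k} {P : Fin (suc k) → Set p} where

  Listing-suc : Listing (λ j → P (suc j)) → Listing P
  Listing-suc (listing r e sat inj) = listing r (λ j → suc (e j)) sat (λ eq → inj (suc-injective eq))

  Listing-cons : P zero → Listing (λ j → P (suc j)) → Listing P
  Listing-cons p₀ (listing r e sat inj) = listing (suc r) e′ sat′ inj′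
    where
    e′ : Fin (suc r) → Fin (suc k)
    e′ zero    = zero
    e′ (suc j) = suc (e j)
    sat′ : ∀ j → P (e′ j)
    sat′ zero    = p₀
    sat′ (suc j) = sat j
    inj′ : Injective _≡_ _≡_ e′
    inj′ {zero}  {zero}  _  = refl
    inj′ {suc x} {suc y} eq = cong suc (inj (suc-injective eq))

  Listing-extend : Dec (P zero) → Listing (λ j → P (suc j)) → Listing P
  Listing-extend (yes p₀) L = Listing-cons p₀ L
  Listing-extend (no _)   L = Listing-suc L

  size-extend : (d : Dec (P zero)) (L : Listing (λ j → P (suc j))) →
    size (Listing-extend d L) ≡ indicator d + size L
  size-extend (yes _) L = refl
  size-extend (no _)  L = refl

fiber : ∀ {k n} (c : Fin k → Fin n) (m : Fin n) → Listing (λ j → c j ≡ m)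
fiber {zero}  c m = listing 0 (λ ()) (λ ()) (λ { {()} })
fiber {suc k} c m = Listing-extend (c zero ≟ m) (fiber (λ j → c (suc j)) m)

sumFin-cong : ∀ n {f g : Fin n → ℕ} → (∀ j → f j ≡ g j) → sumFin n f ≡ sumFin n g
sumFin-cong zero    f≗g = refl
sumFin-cong (suc n) f≗g = cong₂ _+_ (f≗g zero) (sumFin-cong n (λ j → f≗g (suc j)))

sumFin-zero : ∀ n → sumFin n (λ _ → 0) ≡ 0
sumFin-zero zero    = refl
sumFin-zero (suc n) = sumFin-zero n

sumFin-+ : ∀ n (f g : Fin n → ℕ) → sumFin n (λ j → f j + g j) ≡ sumFin n f + sumFin n g
sumFin-+ zero    f g = refl
sumFin-+ (suc n) f g = begin
  (f zero + g zero) + sumFin n (λ j → f (suc j) + g (suc j))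
    ≡⟨ cong (f zero + g zero +_) (sumFin-+ n (λ j → f (suc j)) (λ j → g (suc j))) ⟩
  (f zero + g zero) + (sumFin n (λ j → f (suc j)) + sumFin n (λ j → g (suc j)))
    ≡⟨ interchange (f zero) (g zero) _ _ ⟩
  (f zero + sumFin n (λ j → f (suc j))) + (g zero + sumFin n (λ j → g (suc j))) ∎
  where open ≡-Reasoning

sumFin-mono : ∀ n {f g : Fin n → ℕ} → (∀ j → f j ≤ g j) → sumFin n f ≤ sumFin n g
sumFin-mono zero    f≤g = z≤n
sumFin-mono (suc n) f≤g = +-mono-≤ (f≤g zero) (sumFin-mono n (λ j → f≤g (suc j)))

sumFin-squeeze : ∀ n {f g : Fin n → ℕ} → (∀ j → f j ≤ g j) → sumFin n g ≤ sumFin n f →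
  ∀ j → f j ≡ g j
sumFin-squeeze (suc n) {f} {g} f≤g Σg≤Σf zero = ≤-antisym (f≤g zero)
  (+-cancelʳ-≤ _ _ _ (≤-trans Σg≤Σf (+-monoʳ-≤ (f zero) (sumFin-mono n (λ j → f≤g (suc j))))))
sumFin-squeeze (suc n) {f} {g} f≤g Σg≤Σf (suc j) =
  sumFin-squeeze n (λ j → f≤g (suc j)) (+-cancelˡ-≤ (g zero) _ _ (≤-trans Σg≤Σf (+-monoˡ-≤ _ (f≤g zero)))) j

sumFin-indicator : ∀ n (x : Fin n) → sumFin n (λ m → indicator (x ≟ m)) ≡ 1
sumFin-indicator (suc n) zero    = cong suc (sumFin-zero n)
sumFin-indicator (suc n) (suc x) = sumFin-indicator n x

sumFin-size-fiber : ∀ k n (c : Fin k → Fin n) → sumFin n (λ m → size (fiber c m)) ≡ k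
sumFin-size-fiber zero    n c = sumFin-zero n
sumFin-size-fiber (suc k) n c = begin
  sumFin n (λ m → size (fiber c m))
    ≡⟨ sumFin-cong n (λ m → size-extend {P = λ j → c j ≡ m} (c zero ≟ m) (fiber c′ m)) ⟩
  sumFin n (λ m → indicator (c zero ≟ m) + size (fiber c′ m))
    ≡⟨ sumFin-+ n _ _ ⟩
  sumFin n (λ m → indicator (c zero ≟ m)) + sumFin n (λ m → size (fiber c′ m))
    ≡⟨ cong₂ _+_ (sumFin-indicator n (c zero)) (sumFin-size-fiber k n c′) ⟩
  suc k ∎
  where
  open ≡-Reasoning
  c′ : Fin k → Fin n
  c′ j = c (suc j)

module _ {o ℓ d s : Level} (C : Category o ℓ) (G : GaloisSetting C d s) where
  open Category C
  open GaloisSetting G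

  HomOver-∘ : ∀ {X Y Z W} {g : Hom X Z} {f : Hom Y Z} {i : Hom W Y} {h : Hom X Y} {t : Hom X W} →
    HomOver C g f h → HomOver C h i t → HomOver C g (f ∘ i) t
  HomOver-∘ {f = f} {i} {t = t} g≡fh h≡it = trans g≡fh (trans (cong (f ∘_) h≡it) (sym (assoc f i t)))

  left-cancel : ∀ {X Y Z} {w : Hom Y X} {t : Hom X Y} → w ∘ t ≡ id → (u v : Hom Z X) →
    t ∘ u ≡ t ∘ v → u ≡ v
  left-cancel {w = w} {t} wt≡id u v tu≡tv = begin
    u             ≡⟨ sym (identityˡ u) ⟩
    id ∘ u        ≡⟨ cong (_∘ u) (sym wt≡id) ⟩
    (w ∘ t) ∘ u   ≡⟨ assoc w t u ⟩
    w ∘ (t ∘ u)   ≡⟨ cong (w ∘_) tu≡tv ⟩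
    w ∘ (t ∘ v)   ≡⟨ sym (assoc w t v) ⟩
    (w ∘ t) ∘ v   ≡⟨ cong (_∘ v) wt≡id ⟩
    id ∘ v        ≡⟨ identityˡ v ⟩
    v             ∎
    where open ≡-Reasoning

  -- The section t is split monic, so (G2)(III) makes it invertible, and its inverse must be w.
  section-unique : ∀ {Y B} → D Y → D B → (w : Hom Y B) (t t′ : Hom B Y) →
    HomOver C id w t → HomOver C id w t′ → t ≡ t′
  section-unique dY dB w t t′ id≡wt id≡wt′
    with t⁻¹ , t⁻¹t≡id , tt⁻¹≡id ← G2-monic dB dY t (λ _ → left-cancel (sym id≡wt)) = begin
      t                 ≡⟨ sym (identityʳ t) ⟩
      t ∘ id            ≡⟨ cong (t ∘_) id≡wt′ ⟩
      t ∘ (w ∘ t′)      ≡⟨ cong (λ x → t ∘ (x ∘ t′)) (sym t⁻¹≡w) ⟩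
      t ∘ (t⁻¹ ∘ t′)    ≡⟨ sym (assoc t t⁻¹ t′) ⟩
      (t ∘ t⁻¹) ∘ t′    ≡⟨ cong (_∘ t′) tt⁻¹≡id ⟩
      id ∘ t′           ≡⟨ identityˡ t′ ⟩
      t′                ∎
    where
    open ≡-Reasoning
    t⁻¹≡w : t⁻¹ ≡ w
    t⁻¹≡w = begin
      t⁻¹               ≡⟨ sym (identityˡ t⁻¹) ⟩
      id ∘ t⁻¹          ≡⟨ cong (_∘ t⁻¹) id≡wt ⟩
      (w ∘ t) ∘ t⁻¹     ≡⟨ assoc w t t⁻¹ ⟩
      w ∘ (t ∘ t⁻¹)     ≡⟨ cong (w ∘_) tt⁻¹≡id ⟩
      w ∘ id            ≡⟨ identityʳ w ⟩
      w                 ∎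

  sections-AtMost-one : ∀ {Y B} → D Y → D B → (w : Hom Y B) → AtMost (HomOver C id w) 1
  sections-AtMost-one dY dB w = AtMost-one (section-unique dY dB w)

  module Classification {B U} (dB : D B) {n} (e : Fin n → ArrInto C U)
    (e-covers : ∀ i → Sig (proj₂ i) → Σ[ j ∈ Fin n ] e j ≡ i) where

    class : Hom B U → Fin n
    class h with i , i∈Σ , _ ← G3-exists dB h = proj₁ (e-covers i i∈Σ)

    factor : (h : Hom B U) → Σ (Hom B (proj₁ (e (class h)))) (HomOver C h (proj₂ (e (class h))))
    factor h with i , i∈Σ , h-factors ← G3-exists dB h =
      subst (λ i → Σ (Hom B (proj₁ i)) (HomOver C h (proj₂ i))) (sym (proj₂ (e-covers i i∈Σ))) h-factors

    factor-at : ∀ {h} m → class h ≡ m → Σ (Hom B (proj₁ (e m))) (HomOver C h (proj₂ (e m)))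
    factor-at {h} _ refl = factor h

    module _ {A} {g : Hom B A} {f : Hom U A} (L : Listing (HomOver C g f)) where

      class-of : Fin (size L) → Fin n
      class-of j = class (elem L j)

      fiber-lift : ∀ m → Listing (λ j → class-of j ≡ m) →
        Listing (HomOver C g (f ∘ proj₂ (e m)))
      fiber-lift m F = listing (size F) t
          (λ j → HomOver-∘ (elem-sat L (elem F j)) (proj₂ (over j)))
          (λ {x} {y} tx≡ty → elem-injective F (elem-injective L
            (trans (proj₂ (over x)) (trans (cong (proj₂ (e m) ∘_) tx≡ty) (sym (proj₂ (over y)))))))
        where
        over : ∀ j → Σ (Hom B (proj₁ (e m))) (HomOver C (elem L (elem F j)) (proj₂ (e m)))
        over j = factor-at m (elem-sat F j)
        t : Fin (size F) → Hom B (proj₁ (e m))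
        t j = proj₁ (over j)

      size-fiber : Fin n → ℕ
      size-fiber m = size (fiber class-of m)

      sumFin-size-fiber-class : sumFin n size-fiber ≡ size L
      sumFin-size-fiber-class = sumFin-size-fiber (size L) n class-of

      size-fiber-≤ : (∀ m → AtMost (HomOver C g (f ∘ proj₂ (e m))) (deg (f ∘ proj₂ (e m)))) →
        ∀ m → size-fiber m ≤ deg (f ∘ proj₂ (e m))
      size-fiber-≤ bounds m = size-≤ (bounds m) (fiber-lift m (fiber class-of m))

  module _ {B A U} (dB : D B) (dA : D A) (g : Hom B A) (f : Hom U A)
    (bound-at-Σ : ∀ {X} (i : Hom X U) → Sig i → AtMost (HomOver C g (f ∘ i)) (deg (f ∘ i))) where

    private
      n : ℕ
      n = proj₁ (G4-sum dA f)
      e : Fin n → ArrInto C U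
      e = proj₁ (proj₂ (G4-sum dA f))
      e∈Σ : ∀ m → Sig (proj₂ (e m))
      e∈Σ = proj₁ (proj₂ (proj₂ (G4-sum dA f)))
      e-covers : ∀ i → Sig (proj₂ i) → Σ[ j ∈ Fin n ] e j ≡ i
      e-covers = proj₁ (proj₂ (proj₂ (proj₂ (proj₂ (G4-sum dA f)))))
      deg-sum : deg f ≡ sumFin n (λ m → deg (f ∘ proj₂ (e m)))
      deg-sum = proj₂ (proj₂ (proj₂ (proj₂ (proj₂ (G4-sum dA f)))))
      bounds : ∀ m → AtMost (HomOver C g (f ∘ proj₂ (e m))) (deg (f ∘ proj₂ (e m)))
      bounds m = bound-at-Σ (proj₂ (e m)) (e∈Σ m)
      open Classification dB e e-covers

    deg-bound : AtMost (HomOver C g f) (deg f)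
    deg-bound k h h-sat h-inj = begin
      k                                          ≡⟨ sym (sumFin-size-fiber-class L) ⟩
      sumFin n (size-fiber L)                    ≤⟨ sumFin-mono n (size-fiber-≤ L bounds) ⟩
      sumFin n (λ m → deg (f ∘ proj₂ (e m)))     ≡⟨ sym deg-sum ⟩
      deg f                                      ∎
      where
      open ≤-Reasoning
      L : Listing (HomOver C g f)
      L = listing k h h-sat h-inj

    deg-bound-tight : HasCard (HomOver C g f) (deg f) →
      ∀ {X} (i : Hom X U) → Sig i → HasCard (HomOver C g (f ∘ i)) (deg (f ∘ i))
    deg-bound-tight (_ , h , h-sat , h-inj) {X} i i∈Σ =
      subst (λ i → HasCard (HomOver C g (f ∘ proj₂ i)) (deg (f ∘ proj₂ i))) e-m≡i
        (HasCard-intro (bounds m) (fiber-lift L m (fiber (class-of L) m)) (sharp m))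
      where
      L : Listing (HomOver C g f)
      L = listing (deg f) h h-sat h-inj
      m : Fin n
      m = proj₁ (e-covers (X , i) i∈Σ)
      e-m≡i : e m ≡ (X , i)
      e-m≡i = proj₂ (e-covers (X , i) i∈Σ)
      sharp : ∀ m → size-fiber L m ≡ deg (f ∘ proj₂ (e m))
      sharp = sumFin-squeeze n (size-fiber-≤ L bounds)
        (≤-reflexive (trans (sym deg-sum) (sym (sumFin-size-fiber-class L))))

  deg-bound-D : ∀ {X A B} → D X → D A → D B → (φ : Hom X A) (g : Hom B A) →
    AtMost (HomOver C g φ) (deg φ)
  deg-bound-D {B = B} dX dA dB φ g
    with P , p , q , pb@(_ , universal) ← G1 dX dA dB φ g
    with degφ≡degq , _ ← G4-pullback dX dA dB φ g p q pb =
      subst (AtMost (HomOver C g φ)) (sym degφ≡degq)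
        (AtMost-retract {Q = HomOver C id q} section (p ∘_) section-of-q p∘section sections-bound)
    where
    square : ∀ h → HomOver C g φ h → φ ∘ h ≡ g ∘ id
    square h g≡φh = trans (sym g≡φh) (sym (identityʳ g))
    section : ∀ h → HomOver C g φ h → Hom B P
    section h g≡φh = proj₁ (universal h id (square h g≡φh))
    p∘section : ∀ h g≡φh → p ∘ section h g≡φh ≡ h
    p∘section h g≡φh = proj₁ (proj₂ (universal h id (square h g≡φh)))
    section-of-q : ∀ h g≡φh → HomOver C id q (section h g≡φh)
    section-of-q h g≡φh = sym (proj₁ (proj₂ (proj₂ (universal h id (square h g≡φh)))))
    sections-bound : AtMost (HomOver C id q) (deg q)
    sections-bound = deg-bound dB dB id q (λ i i∈Σ →
      AtMost-weaken {P = HomOver C id (q ∘ i)} (deg-pos dB (q ∘ i))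
        (sections-AtMost-one (Sig-dom i i∈Σ) dB (q ∘ i)))

corollary3p12 : ∀ {o ℓ d s : Level} (C : Category o ℓ) (G : GaloisSetting C d s) →
    let open Category C
        open GaloisSetting G
    in ∀ {B A U} → D B → D A → (g : Hom B A) (f : Hom U A) →
       AtMost (HomOver C g f) (deg f) ×
       (HasCard (HomOver C g f) (deg f) →
         ∀ {X} (i : Hom X U) → Sig i → HasCard (HomOver C g (f ∘ i)) (deg (f ∘ i)))
corollary3p12 C G dB dA g f =
  deg-bound C G dB dA g f bound-at-Σ , deg-bound-tight C G dB dA g f bound-at-Σ
  where
  open Category C
  open GaloisSetting G
  bound-at-Σ : ∀ {X} (i : Hom X _) → Sig i → AtMost (HomOver C g (f ∘ i)) (deg (f ∘ i))
  bound-at-Σ i i∈Σ = deg-bound-D C G (Sig-dom i i∈Σ) dA dB (f ∘ i) g
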